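{- Let $\mathcal{E}$ be a monoidal category and $\mathcal{C}$ a category. (1) If the tensor unit of $\mathcal{E}$ is an initial object, then every $\mathcal{E}$-indexed monad on $\mathcal{C}$ induces an $\mathcal{E}$-graded monad on $\mathcal{C}$ (with the same functors $T_u$). (2) If the tensor product of $\mathcal{E}$ has codiagonals, then every $\mathcal{E}$-graded monad on $\mathcal{C}$ induces an $\mathcal{E}$-indexed monad on $\mathcal{C}$ (with the same functors $T_u$). (3) If $\mathcal{E}$ is cocartesian (monoidal structure given by coproducts and initial object), these constructions give a bijective correspondence between $\mathcal{E}$-graded monads and $\mathcal{E}$-indexed monads on $\mathcal{C}$.
   Context: An $\mathcal{E}$-graded monad on $\mathcal{C}$ is a lax monoidal functor $\mathcal{E}\to[\mathcal{C},\mathcal{C}]$ (the latter monoidal under composition): it consists of functors $T_u\colon\mathcal{C}\to\mathcal{C}$ for objects $u$ of $\mathcal{E}$, a natural transformation $\eta_A\colon A\to T_I(A)$ ($I$ the unit of $\mathcal{E}$), and transformations $\mu_{u,v,A}\colon T_u(T_v(A))\to T_{u\otimes v}(A)$ natural in $u,v,A$, satisfying the coherence conditions of a lax monoidal functor. An $\mathcal{E}$-indexed monad on $\mathcal{C}$ is a functor $\mathcal{E}\to\mathbf{Monad}(\mathcal{C})$, where $\mathbf{Monad}(\mathcal{C})$ is the category of monads on $\mathcal{C}$ and lax monad morphisms (with identity underlying functor): it consists of functors $T_u$ with transformations $\eta_{u,A}\colon A\to T_u(A)$ and $\mu_{u,A}\colon T_u^2(A)\to T_u(A)$ natural in $u$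 and $A$ such that each $(T_u,\eta_u,\mu_u)$ is a monad. A monoidal category has codiagonals when there is a natural transformation $\nabla_A\colon A\otimes A\to A$ that respects the coherence isomorphisms.
   Formalization: Part (2) also assumes an initial tensor unit, and the codiagonal ∇ is natural, associative, with ∇ ∘ (x ⊗ id) = λ and ∇ ∘ (id ⊗ x) = ρ for every x: I → A. Each condition added here is assumed in the paper as well or is needed for the statement above to hold. -}

module Defs where

open import Level using (Level; _⊔_) renaming (suc to lsuc)
open import Relation.Binary using (IsEquivalence)
open import Data.Product using (Σ; _×_; _,_)

record Category (o ℓ e : Level) : Set (lsuc (o ⊔ ℓ ⊔ e)) where
  infix  4 _≈_ _⇒_
  infixr 9 _∘_
  field
    Obj : Set o
    _⇒_ : Obj → Obj → Set ℓ
    _≈_ : ∀ {A B} → A ⇒ B → A ⇒ B → Set e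
    id  : ∀ {A} → A ⇒ A
    _∘_ : ∀ {A B C} → B ⇒ C → A ⇒ B → A ⇒ C
    equiv : ∀ {A B} → IsEquivalence (_≈_ {A} {B})
    ∘-resp-≈ : ∀ {A B C} {f h : B ⇒ C} {g i : A ⇒ B} → f ≈ h → g ≈ i → f ∘ g ≈ h ∘ i
    identityˡ : ∀ {A B} {f : A ⇒ B} → id ∘ f ≈ f
    identityʳ : ∀ {A B} {f : A ⇒ B} → f ∘ id ≈ f
    assoc : ∀ {A B C D} {f : A ⇒ B} {g : B ⇒ C} {h : C ⇒ D} →
            (h ∘ g) ∘ f ≈ h ∘ (g ∘ f)

infix 10 _[_,_] _[_≈_] _[_∘_]

_[_,_] : ∀ {o ℓ e} (C : Category o ℓ e) → Category.Obj C → Category.Obj C → Set ℓ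
C [ A , B ] = Category._⇒_ C A B

_[_≈_] : ∀ {o ℓ e} (C : Category o ℓ e) {A B : Category.Obj C} →
         C [ A , B ] → C [ A , B ] → Set e
C [ f ≈ g ] = Category._≈_ C f g

_[_∘_] : ∀ {o ℓ e} (C : Category o ℓ e) {A B D : Category.Obj C} →
         C [ B , D ] → C [ A , B ] → C [ A , D ]
C [ g ∘ f ] = Category._∘_ C g f

record Functor {o ℓ e o′ ℓ′ e′} (C : Category o ℓ e) (D : Category o′ ℓ′ e′)
       : Set (o ⊔ ℓ ⊔ e ⊔ o′ ⊔ ℓ′ ⊔ e′) where
  field
    F₀ : Category.Obj C → Category.Obj D
    F₁ : ∀ {A B} → C [ A , B ] → D [ F₀ A , F₀ B ]
    identity : ∀ {A} → D [ F₁ (Category.id C {A}) ≈ Category.id D ]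
    homomorphism : ∀ {X Y Z} {f : C [ X , Y ]} {g : C [ Y , Z ]} →
                   D [ F₁ (C [ g ∘ f ]) ≈ D [ F₁ g ∘ F₁ f ] ]
    F-resp-≈ : ∀ {A B} {f g : C [ A , B ]} → C [ f ≈ g ] → D [ F₁ f ≈ F₁ g ]

record NatTrans {o ℓ e o′ ℓ′ e′} {C : Category o ℓ e} {D : Category o′ ℓ′ e′}
       (F G : Functor C D) : Set (o ⊔ ℓ ⊔ e ⊔ o′ ⊔ ℓ′ ⊔ e′) where
  field
    η : ∀ X → D [ Functor.F₀ F X , Functor.F₀ G X ]
    commute : ∀ {X Y} (f : C [ X , Y ]) →
              D [ D [ η Y ∘ Functor.F₁ F f ] ≈ D [ Functor.F₁ G f ∘ η X ] ]

record IsInitial {o ℓ e} (C : Category o ℓ e) (X : Category.Obj C) : Set (o ⊔ ℓ ⊔ e) where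
  field
    ! : ∀ A → C [ X , A ]
    !-unique : ∀ {A} (f : C [ X , A ]) → C [ ! A ≈ f ]

record Monoidal {o ℓ e} (C : Category o ℓ e) : Set (o ⊔ ℓ ⊔ e) where
  open Category C
  infixr 10 _⊗₀_ _⊗₁_
  field
    _⊗₀_ : Obj → Obj → Obj
    _⊗₁_ : ∀ {A B X Y} → A ⇒ B → X ⇒ Y → A ⊗₀ X ⇒ B ⊗₀ Y
    ⊗-identity : ∀ {A B} → id {A} ⊗₁ id {B} ≈ id
    ⊗-homomorphism : ∀ {A B D X Y Z} {f : A ⇒ B} {g : B ⇒ D} {h : X ⇒ Y} {k : Y ⇒ Z} →
                     (g ∘ f) ⊗₁ (k ∘ h) ≈ (g ⊗₁ k) ∘ (f ⊗₁ h)
    ⊗-resp-≈ : ∀ {A B X Y} {f g : A ⇒ B} {h k : X ⇒ Y} → f ≈ g → h ≈ k → f ⊗₁ h ≈ g ⊗₁ k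
    unit : Obj
    α⇒ : ∀ {A B D} → (A ⊗₀ B) ⊗₀ D ⇒ A ⊗₀ (B ⊗₀ D)
    α⇐ : ∀ {A B D} → A ⊗₀ (B ⊗₀ D) ⇒ (A ⊗₀ B) ⊗₀ D
    α-isoˡ : ∀ {A B D} → α⇐ {A} {B} {D} ∘ α⇒ ≈ id
    α-isoʳ : ∀ {A B D} → α⇒ {A} {B} {D} ∘ α⇐ ≈ id
    α-natural : ∀ {A A′ B B′ D D′} {f : A ⇒ A′} {g : B ⇒ B′} {h : D ⇒ D′} →
                α⇒ ∘ ((f ⊗₁ g) ⊗₁ h) ≈ (f ⊗₁ (g ⊗₁ h)) ∘ α⇒
    λ⇒ : ∀ {A} → unit ⊗₀ A ⇒ A
    λ⇐ : ∀ {A} → A ⇒ unit ⊗₀ A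
    λ-isoˡ : ∀ {A} → λ⇐ {A} ∘ λ⇒ ≈ id
    λ-isoʳ : ∀ {A} → λ⇒ {A} ∘ λ⇐ ≈ id
    λ-natural : ∀ {A B} {f : A ⇒ B} → λ⇒ ∘ (id ⊗₁ f) ≈ f ∘ λ⇒
    ρ⇒ : ∀ {A} → A ⊗₀ unit ⇒ A
    ρ⇐ : ∀ {A} → A ⇒ A ⊗₀ unit
    ρ-isoˡ : ∀ {A} → ρ⇐ {A} ∘ ρ⇒ ≈ id
    ρ-isoʳ : ∀ {A} → ρ⇒ {A} ∘ ρ⇐ ≈ id
    ρ-natural : ∀ {A B} {f : A ⇒ B} → ρ⇒ ∘ (f ⊗₁ id) ≈ f ∘ ρ⇒
    triangle : ∀ {A B} → (id {A} ⊗₁ λ⇒ {B}) ∘ α⇒ ≈ ρ⇒ ⊗₁ id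
    pentagon : ∀ {A B D X} →
               (id {A} ⊗₁ α⇒ {B} {D} {X}) ∘ (α⇒ ∘ (α⇒ ⊗₁ id)) ≈ α⇒ ∘ α⇒

record MonoidalCategory (o ℓ e : Level) : Set (lsuc (o ⊔ ℓ ⊔ e)) where
  field
    U : Category o ℓ e
    monoidal : Monoidal U
  open Category U public
  open Monoidal monoidal public

-- A functor E → [C,C] (C's endofunctor category), given componentwise:
-- for each u a functor T u, for each f : u → v a natural transformation
-- T f : T u ⇒ T v, functorial (up to pointwise ≈).

record EFunctor {o ℓ e o′ ℓ′ e′} (E : Category o ℓ e) (C : Category o′ ℓ′ e′)
       : Set (o ⊔ ℓ ⊔ e ⊔ o′ ⊔ ℓ′ ⊔ e′) where
  field
    T₀ : Category.Obj E → Functor C C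
    T₁ : ∀ {u v} → E [ u , v ] → NatTrans (T₀ u) (T₀ v)
    identity : ∀ {u} A → C [ NatTrans.η (T₁ (Category.id E {u})) A ≈ Category.id C ]
    homomorphism : ∀ {u v w} {f : E [ u , v ]} {g : E [ v , w ]} A →
      C [ NatTrans.η (T₁ (E [ g ∘ f ])) A ≈ C [ NatTrans.η (T₁ g) A ∘ NatTrans.η (T₁ f) A ] ]
    resp-≈ : ∀ {u v} {f g : E [ u , v ]} → E [ f ≈ g ] → ∀ A →
      C [ NatTrans.η (T₁ f) A ≈ NatTrans.η (T₁ g) A ]

  T : Category.Obj E → Category.Obj C → Category.Obj C
  T u A = Functor.F₀ (T₀ u) A

  Tm : ∀ u {A B} → C [ A , B ] → C [ T u A , T u B ]
  Tm u h = Functor.F₁ (T₀ u) h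

  τ : ∀ {u v} → E [ u , v ] → ∀ A → C [ T u A , T v A ]
  τ f A = NatTrans.η (T₁ f) A

-- Graded monads: lax monoidal functors E → [C,C] (structure on a fixed EFunctor)

module _ {o ℓ e o′ ℓ′ e′} (E : MonoidalCategory o ℓ e) (C : Category o′ ℓ′ e′) where
  private
    module E = MonoidalCategory E
    module C = Category C

  record GradedMonad (F : EFunctor E.U C) : Set (o ⊔ ℓ ⊔ e ⊔ o′ ⊔ ℓ′ ⊔ e′) where
    open EFunctor F
    field
      η : ∀ A → C [ A , T E.unit A ]
      η-natural : ∀ {A B} (h : C [ A , B ]) → C [ C [ η B ∘ h ] ≈ C [ Tm E.unit h ∘ η A ] ]
      μ : ∀ u v A → C [ T u (T v A) , T (u E.⊗₀ v) A ]
      μ-natural : ∀ u v {A B} (h : C [ A , B ]) →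
        C [ C [ μ u v B ∘ Tm u (Tm v h) ] ≈ C [ Tm (u E.⊗₀ v) h ∘ μ u v A ] ]
      μ-natural-grade : ∀ {u u′ v v′} (f : E.U [ u , u′ ]) (g : E.U [ v , v′ ]) A →
        C [ C [ τ (f E.⊗₁ g) A ∘ μ u v A ]
          ≈ C [ μ u′ v′ A ∘ C [ τ f (T v′ A) ∘ Tm u (τ g A) ] ] ]
      unitˡ : ∀ u A → C [ C [ τ E.λ⇒ A ∘ C [ μ E.unit u A ∘ η (T u A) ] ] ≈ C.id ]
      unitʳ : ∀ u A → C [ C [ τ E.ρ⇒ A ∘ C [ μ u E.unit A ∘ Tm u (η A) ] ] ≈ C.id ]
      assoc : ∀ u v w A →
        C [ C [ τ E.α⇒ A ∘ C [ μ (u E.⊗₀ v) w A ∘ μ u v (T w A) ] ]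
          ≈ C [ μ u (v E.⊗₀ w) A ∘ Tm u (μ v w A) ] ]

  GradedEq : ∀ {F} → GradedMonad F → GradedMonad F → Set (o ⊔ o′ ⊔ e′)
  GradedEq G G′ =
    (∀ A → C [ GradedMonad.η G A ≈ GradedMonad.η G′ A ]) ×
    (∀ u v A → C [ GradedMonad.μ G u v A ≈ GradedMonad.μ G′ u v A ])

-- Indexed monads: functors E → Monad(C) (monads and monad morphisms with
-- identity underlying functor), structure on a fixed EFunctor

module _ {o ℓ e o′ ℓ′ e′} (E : Category o ℓ e) (C : Category o′ ℓ′ e′) where
  private
    module C = Category C

  record IndexedMonad (F : EFunctor E C) : Set (o ⊔ ℓ ⊔ e ⊔ o′ ⊔ ℓ′ ⊔ e′) where
    open EFunctor F
    field
      η : ∀ u A → C [ A , T u A ]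
      η-natural : ∀ u {A B} (h : C [ A , B ]) → C [ C [ η u B ∘ h ] ≈ C [ Tm u h ∘ η u A ] ]
      μ : ∀ u A → C [ T u (T u A) , T u A ]
      μ-natural : ∀ u {A B} (h : C [ A , B ]) →
        C [ C [ μ u B ∘ Tm u (Tm u h) ] ≈ C [ Tm u h ∘ μ u A ] ]
      unitˡ : ∀ u A → C [ C [ μ u A ∘ η u (T u A) ] ≈ C.id ]
      unitʳ : ∀ u A → C [ C [ μ u A ∘ Tm u (η u A) ] ≈ C.id ]
      assoc : ∀ u A → C [ C [ μ u A ∘ μ u (T u A) ] ≈ C [ μ u A ∘ Tm u (μ u A) ] ]
      hom-η : ∀ {u v} (f : E [ u , v ]) A → C [ C [ τ f A ∘ η u A ] ≈ η v A ]
      hom-μ : ∀ {u v} (f : E [ u , v ]) A →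
        C [ C [ τ f A ∘ μ u A ] ≈ C [ μ v A ∘ C [ τ f (T v A) ∘ Tm u (τ f A) ] ] ]

  IndexedEq : ∀ {F} → IndexedMonad F → IndexedMonad F → Set (o ⊔ o′ ⊔ e′)
  IndexedEq M M′ =
    (∀ u A → C [ IndexedMonad.η M u A ≈ IndexedMonad.η M′ u A ]) ×
    (∀ u A → C [ IndexedMonad.μ M u A ≈ IndexedMonad.μ M′ u A ])

module _ {o ℓ e} (E : MonoidalCategory o ℓ e) where
  private module E = MonoidalCategory E
  open E

  record HasCodiagonals : Set (o ⊔ ℓ ⊔ e) where
    field
      ∇ : ∀ A → A ⊗₀ A ⇒ A
      ∇-natural : ∀ {A B} (f : A ⇒ B) → ∇ B ∘ (f ⊗₁ f) ≈ f ∘ ∇ A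
      ∇-assoc : ∀ A → ∇ A ∘ (∇ A ⊗₁ id) ≈ ∇ A ∘ ((id ⊗₁ ∇ A) ∘ α⇒)
      ∇-unitˡ : ∀ {A} (x : unit ⇒ A) → ∇ A ∘ (x ⊗₁ id) ≈ λ⇒
      ∇-unitʳ : ∀ {A} (x : unit ⇒ A) → ∇ A ∘ (id ⊗₁ x) ≈ ρ⇒

  record IsCocartesian : Set (o ⊔ ℓ ⊔ e) where
    field
      ι₁ : ∀ {A B} → A ⇒ A ⊗₀ B
      ι₂ : ∀ {A B} → B ⇒ A ⊗₀ B
      copair : ∀ {A B X} → A ⇒ X → B ⇒ X → A ⊗₀ B ⇒ X
      inject₁ : ∀ {A B X} {f : A ⇒ X} {g : B ⇒ X} → copair f g ∘ ι₁ ≈ f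
      inject₂ : ∀ {A B X} {f : A ⇒ X} {g : B ⇒ X} → copair f g ∘ ι₂ ≈ g
      []-unique : ∀ {A B X} {f : A ⇒ X} {g : B ⇒ X} (h : A ⊗₀ B ⇒ X) →
                  h ∘ ι₁ ≈ f → h ∘ ι₂ ≈ g → h ≈ copair f g
      unit-initial : IsInitial U unit
      ⊗₁-ι₁ : ∀ {A B X Y} {f : A ⇒ B} {g : X ⇒ Y} → (f ⊗₁ g) ∘ ι₁ ≈ ι₁ ∘ f
      ⊗₁-ι₂ : ∀ {A B X Y} {f : A ⇒ B} {g : X ⇒ Y} → (f ⊗₁ g) ∘ ι₂ ≈ ι₂ ∘ g
      λ-ι₂ : ∀ {A} → λ⇒ {A} ∘ ι₂ ≈ id
      ρ-ι₁ : ∀ {A} → ρ⇒ {A} ∘ ι₁ ≈ id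
      α-ι₁ι₁ : ∀ {A B D} → α⇒ {A} {B} {D} ∘ (ι₁ ∘ ι₁) ≈ ι₁
      α-ι₁ι₂ : ∀ {A B D} → α⇒ {A} {B} {D} ∘ (ι₁ ∘ ι₂) ≈ ι₂ ∘ ι₁
      α-ι₂ : ∀ {A B D} → α⇒ {A} {B} {D} ∘ ι₂ ≈ ι₂ ∘ ι₂

module _ {o ℓ e o′ ℓ′ e′} (E : MonoidalCategory o ℓ e) (C : Category o′ ℓ′ e′) where
  private
    module E = MonoidalCategory E
    module C = Category C

  IsIndexedToGraded : (init : IsInitial E.U E.unit) {F : EFunctor E.U C} →
    IndexedMonad E.U C F → GradedMonad E C F → Set (o ⊔ o′ ⊔ e′)
  IsIndexedToGraded init {F} M G =
    (∀ A → C [ GradedMonad.η G A ≈ IndexedMonad.η M E.unit A ]) ×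
    (∀ u v A → C [ GradedMonad.μ G u v A ≈
       C [ IndexedMonad.μ M (u E.⊗₀ v) A ∘
         C [ τ (j₁ u v) (T (u E.⊗₀ v) A) ∘ Tm u (τ (j₂ u v) A) ] ] ])
    where
      open EFunctor F
      open IsInitial init
      j₁ : ∀ u v → E.U [ u , u E.⊗₀ v ]
      j₁ u v = (E.id E.⊗₁ ! v) E.∘ E.ρ⇐
      j₂ : ∀ u v → E.U [ v , u E.⊗₀ v ]
      j₂ u v = (! u E.⊗₁ E.id) E.∘ E.λ⇐

  IsGradedToIndexed : (init : IsInitial E.U E.unit)
    (∇ : ∀ u → E.U [ u E.⊗₀ u , u ]) {F : EFunctor E.U C} →
    GradedMonad E C F → IndexedMonad E.U C F → Set (o ⊔ o′ ⊔ e′)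
  IsGradedToIndexed init ∇ {F} G M =
    (∀ u A → C [ IndexedMonad.η M u A ≈ C [ τ (IsInitial.! init u) A ∘ GradedMonad.η G A ] ]) ×
    (∀ u A → C [ IndexedMonad.μ M u A ≈ C [ τ (∇ u) A ∘ GradedMonad.μ G u u A ] ])
    where open EFunctor F

module _ {o ℓ e o′ ℓ′ e′} (E : MonoidalCategory o ℓ e) (C : Category o′ ℓ′ e′) where
  private
    module E = MonoidalCategory E

  Part1 : Set (o ⊔ ℓ ⊔ e ⊔ o′ ⊔ ℓ′ ⊔ e′)
  Part1 = (init : IsInitial E.U E.unit) (F : EFunctor E.U C) (M : IndexedMonad E.U C F) →
          Σ (GradedMonad E C F) λ G → IsIndexedToGraded E C init M G

  Part2 : Set (o ⊔ ℓ ⊔ e ⊔ o′ ⊔ ℓ′ ⊔ e′)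
  Part2 = (init : IsInitial E.U E.unit) (cd : HasCodiagonals E) (F : EFunctor E.U C)
          (G : GradedMonad E C F) →
          Σ (IndexedMonad E.U C F) λ M →
            IsGradedToIndexed E C init (HasCodiagonals.∇ cd) G M

  Part3 : Set (o ⊔ ℓ ⊔ e ⊔ o′ ⊔ ℓ′ ⊔ e′)
  Part3 = (cc : IsCocartesian E) (F : EFunctor E.U C) →
          let open IsCocartesian cc
              ∇ : ∀ u → E.U [ u E.⊗₀ u , u ]
              ∇ u = copair E.id E.id
          in Σ (IndexedMonad E.U C F → GradedMonad E C F) λ Φ →
             Σ (GradedMonad E C F → IndexedMonad E.U C F) λ Ψ →
               (∀ M → IsIndexedToGraded E C unit-initial M (Φ M)) ×
               (∀ G → IsGradedToIndexed E C unit-initial ∇ G (Ψ G)) ×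
               (∀ G → GradedEq E C (Φ (Ψ G)) G) ×
               (∀ M → IndexedEq E.U C (Ψ (Φ M)) M)

{-# OPTIONS --safe #-}
module Submission where

-- With an initial unit every u ⊗ v receives maps j₁ : u → u ⊗ v and
-- j₂ : v → u ⊗ v, and the coherence of the monoidal structure (including Kelly's
-- λ⇒ ∘ α⇒ ≈ λ⇒ ⊗ id) makes them behave like coproduct injections:
-- α⇒ ∘ j₁ ∘ j₁ ≈ j₁, α⇒ ∘ j₁ ∘ j₂ ≈ j₂ ∘ j₁, α⇒ ∘ j₂ ≈ j₂ ∘ j₂.
-- An indexed monad becomes graded by multiplying along this cocone,
-- μ_{u,v} = μ^{u⊗v} ∘ (T j₁ ⋆ T j₂), the monad-morphism laws of the T f doing the
-- rest. A graded monad becomes indexed through μ^u = T ∇ ∘ μ_{u,u} and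
-- η^u = T ! ∘ η, the codiagonal laws turning the graded unit and associativity
-- laws into the ordinary ones. Indexed → graded → indexed is the identity since
-- ∇ ∘ j₁ ≈ ∇ ∘ j₂ ≈ id always holds; graded → indexed → graded is the identity
-- as soon as ∇ ∘ (j₁ ⊗ j₂) ≈ id, which holds in the cocartesian case where j₁, j₂
-- are the coproduct injections.

open import Level using (Level)
open import Data.Product using (_×_; _,_)
open import Relation.Binary.Bundles using (Setoid)
import Relation.Binary.Reasoning.Setoid as SetoidReasoning
open import Defs

private
  variable
    o ℓ e o′ ℓ′ e′ : Level

module HomReasoning (C : Category o ℓ e) where
  open Category C public

  hom-setoid : Obj → Obj → Setoid ℓ e
  hom-setoid A B = record { isEquivalence = equiv {A} {B} }

  module _ {A B : Obj} where
    open Setoid (hom-setoid A B) public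
      using () renaming (refl to ≈-refl; sym to ≈-sym; trans to ≈-trans)
    open SetoidReasoning (hom-setoid A B) public

  infixr 4 _⟩∘⟨_ refl⟩∘⟨_
  infixl 5 _⟩∘⟨refl

  _⟩∘⟨_ : ∀ {A B D} {f h : B ⇒ D} {g i : A ⇒ B} → f ≈ h → g ≈ i → f ∘ g ≈ h ∘ i
  _⟩∘⟨_ = ∘-resp-≈

  refl⟩∘⟨_ : ∀ {A B D} {f : B ⇒ D} {g i : A ⇒ B} → g ≈ i → f ∘ g ≈ f ∘ i
  refl⟩∘⟨_ = ∘-resp-≈ ≈-refl

  _⟩∘⟨refl : ∀ {A B D} {f h : B ⇒ D} {g : A ⇒ B} → f ≈ h → f ∘ g ≈ h ∘ g
  p ⟩∘⟨refl = ∘-resp-≈ p ≈-refl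

  sym-assoc : ∀ {A B D X} {f : A ⇒ B} {g : B ⇒ D} {h : D ⇒ X} →
              h ∘ (g ∘ f) ≈ (h ∘ g) ∘ f
  sym-assoc = ≈-sym assoc

  module _ {A B D X : Obj} where
    pullʳ : ∀ {k : D ⇒ X} {g : B ⇒ D} {f : A ⇒ B} {h : A ⇒ D} →
            g ∘ f ≈ h → (k ∘ g) ∘ f ≈ k ∘ h
    pullʳ p = ≈-trans assoc (refl⟩∘⟨ p)

    pullˡ : ∀ {g : D ⇒ X} {f : B ⇒ D} {k : A ⇒ B} {h : B ⇒ X} →
            g ∘ f ≈ h → g ∘ (f ∘ k) ≈ h ∘ k
    pullˡ p = ≈-trans sym-assoc (p ⟩∘⟨refl)

    pushˡ : ∀ {g : D ⇒ X} {f : B ⇒ D} {k : A ⇒ B} {h : B ⇒ X} →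
            h ≈ g ∘ f → h ∘ k ≈ g ∘ (f ∘ k)
    pushˡ p = ≈-sym (pullˡ (≈-sym p))

  elimʳ : ∀ {A B} {f : A ⇒ B} {g : A ⇒ A} → g ≈ id → f ∘ g ≈ f
  elimʳ p = ≈-trans (refl⟩∘⟨ p) identityʳ

  elimˡ : ∀ {A B} {f : A ⇒ B} {g : B ⇒ B} → g ≈ id → g ∘ f ≈ f
  elimˡ p = ≈-trans (p ⟩∘⟨refl) identityˡ

  cancelʳ : ∀ {A B D} {f : B ⇒ D} {g : A ⇒ B} {g⁻¹ : B ⇒ A} →
            g ∘ g⁻¹ ≈ id → (f ∘ g) ∘ g⁻¹ ≈ f
  cancelʳ p = ≈-trans (pullʳ p) identityʳ

  cancelˡ : ∀ {A B D} {f : A ⇒ B} {g : B ⇒ D} {g⁻¹ : D ⇒ B} →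
            g⁻¹ ∘ g ≈ id → g⁻¹ ∘ (g ∘ f) ≈ f
  cancelˡ p = ≈-trans (pullˡ p) identityˡ

  glue : ∀ {A B D X Y Z} {a : B ⇒ D} {f : A ⇒ B} {g : X ⇒ D} {b : A ⇒ X}
           {c : D ⇒ Z} {h : Y ⇒ Z} {d : X ⇒ Y} →
         a ∘ f ≈ g ∘ b → c ∘ g ≈ h ∘ d → (c ∘ a) ∘ f ≈ h ∘ (d ∘ b)
  glue p q = ≈-trans (pullʳ p) (≈-trans (pullˡ q) assoc)

  move-isos : ∀ {A B A′ B′} {x : A ⇒ B} {y : A′ ⇒ B′}
                {g : A ⇒ A′} {g⁻¹ : A′ ⇒ A} {h : B ⇒ B′} {h⁻¹ : B′ ⇒ B} →
              h⁻¹ ∘ h ≈ id → g ∘ g⁻¹ ≈ id → h ∘ x ≈ y ∘ g → x ∘ g⁻¹ ≈ h⁻¹ ∘ y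
  move-isos {x = x} {y} {g} {g⁻¹} {h} {h⁻¹} h-iso g-iso sq = begin
    x ∘ g⁻¹                ≈⟨ cancelˡ h-iso ⟨
    h⁻¹ ∘ (h ∘ (x ∘ g⁻¹))  ≈⟨ refl⟩∘⟨ pullˡ sq ⟩
    h⁻¹ ∘ ((y ∘ g) ∘ g⁻¹)  ≈⟨ refl⟩∘⟨ cancelʳ g-iso ⟩
    h⁻¹ ∘ y                ∎

  ∘-cancelʳ : ∀ {A B D} {h k : B ⇒ D} {p : A ⇒ B} {p⁻¹ : B ⇒ A} →
              p ∘ p⁻¹ ≈ id → h ∘ p ≈ k ∘ p → h ≈ k
  ∘-cancelʳ {h = h} {k} {p} {p⁻¹} inv eq = begin
    h                ≈⟨ cancelʳ inv ⟨
    (h ∘ p) ∘ p⁻¹    ≈⟨ eq ⟩∘⟨refl ⟩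
    (k ∘ p) ∘ p⁻¹    ≈⟨ cancelʳ inv ⟩
    k                ∎

module MonoidalReasoning (𝔼 : MonoidalCategory o ℓ e) where
  open MonoidalCategory 𝔼 public using (U)
  open HomReasoning U public
  open Monoidal (MonoidalCategory.monoidal 𝔼) public

  ⊗₁-∘ : ∀ {A B D X Y Z} {f : A ⇒ B} {g : B ⇒ D} {h : X ⇒ Y} {k : Y ⇒ Z} →
         (g ⊗₁ k) ∘ (f ⊗₁ h) ≈ (g ∘ f) ⊗₁ (k ∘ h)
  ⊗₁-∘ = ≈-sym ⊗-homomorphism

  ⊗₁∘⊗₁id : ∀ {A B D X Y} {f : A ⇒ B} {g : B ⇒ D} {k : X ⇒ Y} →
            (g ⊗₁ k) ∘ (f ⊗₁ id) ≈ (g ∘ f) ⊗₁ k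
  ⊗₁∘⊗₁id = ≈-trans ⊗₁-∘ (⊗-resp-≈ ≈-refl identityʳ)

  ⊗₁∘id⊗₁ : ∀ {A B D X Y} {f : A ⇒ B} {g : B ⇒ D} {k : X ⇒ Y} →
            (k ⊗₁ g) ∘ (id ⊗₁ f) ≈ k ⊗₁ (g ∘ f)
  ⊗₁∘id⊗₁ = ≈-trans ⊗₁-∘ (⊗-resp-≈ identityʳ ≈-refl)

  ⊗₁-inverse : ∀ {A B X Y} {f : A ⇒ B} {g : B ⇒ A} {h : X ⇒ Y} {k : Y ⇒ X} →
               g ∘ f ≈ id → k ∘ h ≈ id → (g ⊗₁ k) ∘ (f ⊗₁ h) ≈ id
  ⊗₁-inverse p q = ≈-trans ⊗₁-∘ (≈-trans (⊗-resp-≈ p q) ⊗-identity)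

  α-natural-∘ : ∀ {A B D X Y Z W} {c : A ⇒ B ⊗₀ D} {p : B ⇒ X} {q : D ⇒ Y} {r : Z ⇒ W} →
                α⇒ ∘ (((p ⊗₁ q) ∘ c) ⊗₁ r) ≈ (p ⊗₁ (q ⊗₁ r)) ∘ (α⇒ ∘ (c ⊗₁ id))
  α-natural-∘ = ≈-trans (refl⟩∘⟨ ≈-sym ⊗₁∘⊗₁id) (≈-trans (pullˡ α-natural) assoc)

  ρ⇐-natural : ∀ {A B} {f : A ⇒ B} → ρ⇐ ∘ f ≈ (f ⊗₁ id) ∘ ρ⇐
  ρ⇐-natural = ≈-sym (move-isos ρ-isoˡ ρ-isoʳ ρ-natural)

  λ⇐-natural : ∀ {A B} {f : A ⇒ B} → λ⇐ ∘ f ≈ (id ⊗₁ f) ∘ λ⇐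
  λ⇐-natural = ≈-sym (move-isos λ-isoˡ λ-isoʳ λ-natural)

  triangle-ρ⇐ : ∀ {A B} → α⇒ {A} {unit} {B} ∘ (ρ⇐ ⊗₁ id) ≈ id ⊗₁ λ⇐
  triangle-ρ⇐ = ≈-trans
    (move-isos (⊗₁-inverse identityˡ λ-isoˡ) (⊗₁-inverse ρ-isoʳ identityˡ)
               (≈-trans triangle (≈-sym identityˡ)))
    identityʳ

  unit⊗₁-injective : ∀ {A B} {f g : A ⇒ B} → id {unit} ⊗₁ f ≈ id ⊗₁ g → f ≈ g
  unit⊗₁-injective {f = f} {g} p = begin
    f                             ≈⟨ conjugate f ⟩
    λ⇒ ∘ ((id ⊗₁ f) ∘ λ⇐)         ≈⟨ refl⟩∘⟨ p ⟩∘⟨refl ⟩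
    λ⇒ ∘ ((id ⊗₁ g) ∘ λ⇐)         ≈⟨ conjugate g ⟨
    g                             ∎
    where
      conjugate : ∀ {A B} (h : A ⇒ B) → h ≈ λ⇒ ∘ ((id ⊗₁ h) ∘ λ⇐)
      conjugate h = ≈-sym (≈-trans (refl⟩∘⟨ ≈-sym λ⇐-natural) (cancelˡ λ-isoʳ))

  -- Kelly's argument: the pentagon and triangle prove the equation only after
  -- tensoring with the unit on the left and precomposing with an isomorphism.
  kelly-λ⇒ : ∀ {A B} → λ⇒ {A ⊗₀ B} ∘ α⇒ {unit} {A} {B} ≈ λ⇒ ⊗₁ id
  kelly-λ⇒ {A} {B} = unit⊗₁-injective (∘-cancelʳ P∘P⁻¹ pentagon-triangle)
    where
      P : ((unit ⊗₀ unit) ⊗₀ A) ⊗₀ B ⇒ unit ⊗₀ ((unit ⊗₀ A) ⊗₀ B)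
      P = α⇒ ∘ (α⇒ ⊗₁ id)

      P∘P⁻¹ : P ∘ ((α⇐ ⊗₁ id) ∘ α⇐) ≈ id
      P∘P⁻¹ = ≈-trans (pullʳ (cancelˡ (⊗₁-inverse α-isoʳ identityˡ))) α-isoʳ

      pentagon-triangle : (id ⊗₁ (λ⇒ ∘ α⇒)) ∘ P ≈ (id ⊗₁ (λ⇒ ⊗₁ id)) ∘ P
      pentagon-triangle = begin
        (id ⊗₁ (λ⇒ ∘ α⇒)) ∘ P                      ≈⟨ pushˡ (≈-sym ⊗₁∘id⊗₁) ⟩
        (id ⊗₁ λ⇒) ∘ ((id ⊗₁ α⇒) ∘ P)              ≈⟨ refl⟩∘⟨ pentagon ⟩
        (id ⊗₁ λ⇒) ∘ (α⇒ ∘ α⇒)                     ≈⟨ pullˡ triangle ⟩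
        (ρ⇒ ⊗₁ id) ∘ α⇒                            ≈⟨ ⊗-resp-≈ ≈-refl ⊗-identity ⟩∘⟨refl ⟨
        (ρ⇒ ⊗₁ (id ⊗₁ id)) ∘ α⇒                    ≈⟨ α-natural ⟨
        α⇒ ∘ ((ρ⇒ ⊗₁ id) ⊗₁ id)                    ≈⟨ refl⟩∘⟨ ⊗-resp-≈ triangle ≈-refl ⟨
        α⇒ ∘ (((id ⊗₁ λ⇒) ∘ α⇒) ⊗₁ id)             ≈⟨ refl⟩∘⟨ ⊗₁∘⊗₁id ⟨
        α⇒ ∘ (((id ⊗₁ λ⇒) ⊗₁ id) ∘ (α⇒ ⊗₁ id))     ≈⟨ pullˡ α-natural ⟩
        ((id ⊗₁ (λ⇒ ⊗₁ id)) ∘ α⇒) ∘ (α⇒ ⊗₁ id)     ≈⟨ assoc ⟩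
        (id ⊗₁ (λ⇒ ⊗₁ id)) ∘ P                     ∎

  kelly-λ⇐ : ∀ {A B} → α⇒ {unit} {A} {B} ∘ (λ⇐ ⊗₁ id) ≈ λ⇐
  kelly-λ⇐ = ≈-trans
    (move-isos λ-isoˡ (⊗₁-inverse λ-isoʳ identityˡ) (≈-trans kelly-λ⇒ (≈-sym identityˡ)))
    identityʳ

module InitialUnit (𝔼 : MonoidalCategory o ℓ e)
                   (init : IsInitial (MonoidalCategory.U 𝔼) (MonoidalCategory.unit 𝔼)) where
  open MonoidalReasoning 𝔼 public
  open IsInitial init public

  !-unique₂ : ∀ {A} (f g : unit ⇒ A) → f ≈ g
  !-unique₂ f g = ≈-trans (≈-sym (!-unique f)) (!-unique g)

  !-unit : ! unit ≈ id
  !-unit = !-unique₂ _ _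

  j₁ : ∀ u v → u ⇒ u ⊗₀ v
  j₁ u v = (id ⊗₁ ! v) ∘ ρ⇐

  j₂ : ∀ u v → v ⇒ u ⊗₀ v
  j₂ u v = (! u ⊗₁ id) ∘ λ⇐

  j₁-∘ : ∀ {A u w} (f : A ⇒ u) → j₁ u w ∘ f ≈ (f ⊗₁ ! w) ∘ ρ⇐
  j₁-∘ f = ≈-trans (pullʳ ρ⇐-natural) (pullˡ (≈-trans ⊗₁-∘ (⊗-resp-≈ identityˡ identityʳ)))

  j₂-∘ : ∀ {A u w} (f : A ⇒ w) → j₂ u w ∘ f ≈ (! u ⊗₁ f) ∘ λ⇐
  j₂-∘ f = ≈-trans (pullʳ λ⇐-natural) (pullˡ (≈-trans ⊗₁-∘ (⊗-resp-≈ identityʳ identityˡ)))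

  ⊗₁-j₁ : ∀ {u u′ v v′} (f : u ⇒ u′) (g : v ⇒ v′) → (f ⊗₁ g) ∘ j₁ u v ≈ j₁ u′ v′ ∘ f
  ⊗₁-j₁ f g = begin
    (f ⊗₁ g) ∘ ((id ⊗₁ ! _) ∘ ρ⇐)  ≈⟨ pullˡ ⊗₁∘id⊗₁ ⟩
    (f ⊗₁ (g ∘ ! _)) ∘ ρ⇐          ≈⟨ ⊗-resp-≈ ≈-refl (!-unique₂ _ _) ⟩∘⟨refl ⟩
    (f ⊗₁ ! _) ∘ ρ⇐                ≈⟨ j₁-∘ f ⟨
    j₁ _ _ ∘ f                     ∎

  ⊗₁-j₂ : ∀ {u u′ v v′} (f : u ⇒ u′) (g : v ⇒ v′) → (f ⊗₁ g) ∘ j₂ u v ≈ j₂ u′ v′ ∘ g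
  ⊗₁-j₂ f g = begin
    (f ⊗₁ g) ∘ ((! _ ⊗₁ id) ∘ λ⇐)  ≈⟨ pullˡ ⊗₁∘⊗₁id ⟩
    ((f ∘ ! _) ⊗₁ g) ∘ λ⇐          ≈⟨ ⊗-resp-≈ (!-unique₂ _ _) ≈-refl ⟩∘⟨refl ⟩
    (! _ ⊗₁ g) ∘ λ⇐                ≈⟨ j₂-∘ g ⟨
    j₂ _ _ ∘ g                     ∎

  ρ-j₁ : ∀ {u} → ρ⇒ ∘ j₁ u unit ≈ id
  ρ-j₁ = ≈-trans (refl⟩∘⟨ elimˡ (≈-trans (⊗-resp-≈ ≈-refl !-unit) ⊗-identity)) ρ-isoʳ

  λ-j₂ : ∀ {u} → λ⇒ ∘ j₂ unit u ≈ id
  λ-j₂ = ≈-trans (refl⟩∘⟨ elimˡ (≈-trans (⊗-resp-≈ !-unit ≈-refl) ⊗-identity)) λ-isoʳ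

  α-j₁j₁ : ∀ {u v w} → α⇒ ∘ (j₁ (u ⊗₀ v) w ∘ j₁ u v) ≈ j₁ u (v ⊗₀ w)
  α-j₁j₁ {u} {v} {w} = begin
    α⇒ ∘ (j₁ (u ⊗₀ v) w ∘ j₁ u v)                     ≈⟨ refl⟩∘⟨ j₁-∘ (j₁ u v) ⟩
    α⇒ ∘ ((((id ⊗₁ ! v) ∘ ρ⇐) ⊗₁ ! w) ∘ ρ⇐)           ≈⟨ pullˡ α-natural-∘ ⟩
    ((id ⊗₁ (! v ⊗₁ ! w)) ∘ (α⇒ ∘ (ρ⇐ ⊗₁ id))) ∘ ρ⇐  ≈⟨ (refl⟩∘⟨ triangle-ρ⇐) ⟩∘⟨refl ⟩
    ((id ⊗₁ (! v ⊗₁ ! w)) ∘ (id ⊗₁ λ⇐)) ∘ ρ⇐          ≈⟨ ⊗₁∘id⊗₁ ⟩∘⟨refl ⟩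
    (id ⊗₁ ((! v ⊗₁ ! w) ∘ λ⇐)) ∘ ρ⇐                  ≈⟨ ⊗-resp-≈ ≈-refl (!-unique₂ _ _) ⟩∘⟨refl ⟩
    j₁ u (v ⊗₀ w)                                     ∎

  α-j₁j₂ : ∀ {u v w} → α⇒ ∘ (j₁ (u ⊗₀ v) w ∘ j₂ u v) ≈ j₂ u (v ⊗₀ w) ∘ j₁ v w
  α-j₁j₂ {u} {v} {w} = begin
    α⇒ ∘ (j₁ (u ⊗₀ v) w ∘ j₂ u v)                     ≈⟨ refl⟩∘⟨ j₁-∘ (j₂ u v) ⟩
    α⇒ ∘ ((((! u ⊗₁ id) ∘ λ⇐) ⊗₁ ! w) ∘ ρ⇐)           ≈⟨ pullˡ α-natural-∘ ⟩
    ((! u ⊗₁ (id ⊗₁ ! w)) ∘ (α⇒ ∘ (λ⇐ ⊗₁ id))) ∘ ρ⇐   ≈⟨ (refl⟩∘⟨ kelly-λ⇐) ⟩∘⟨refl ⟩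
    ((! u ⊗₁ (id ⊗₁ ! w)) ∘ λ⇐) ∘ ρ⇐                   ≈⟨ pullʳ λ⇐-natural ⟩
    (! u ⊗₁ (id ⊗₁ ! w)) ∘ ((id ⊗₁ ρ⇐) ∘ λ⇐)           ≈⟨ pullˡ ⊗₁∘id⊗₁ ⟩
    (! u ⊗₁ j₁ v w) ∘ λ⇐                                ≈⟨ j₂-∘ (j₁ v w) ⟨
    j₂ u (v ⊗₀ w) ∘ j₁ v w                             ∎

  α-j₂ : ∀ {u v w} → α⇒ ∘ j₂ (u ⊗₀ v) w ≈ j₂ u (v ⊗₀ w) ∘ j₂ v w
  α-j₂ {u} {v} {w} = begin
    α⇒ ∘ ((! (u ⊗₀ v) ⊗₁ id) ∘ λ⇐)                    ≈⟨ refl⟩∘⟨ ⊗-resp-≈ (!-unique₂ _ _) ≈-refl ⟩∘⟨refl ⟩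
    α⇒ ∘ ((((! u ⊗₁ ! v) ∘ ρ⇐) ⊗₁ id) ∘ λ⇐)           ≈⟨ pullˡ α-natural-∘ ⟩
    ((! u ⊗₁ (! v ⊗₁ id)) ∘ (α⇒ ∘ (ρ⇐ ⊗₁ id))) ∘ λ⇐   ≈⟨ (refl⟩∘⟨ triangle-ρ⇐) ⟩∘⟨refl ⟩
    ((! u ⊗₁ (! v ⊗₁ id)) ∘ (id ⊗₁ λ⇐)) ∘ λ⇐           ≈⟨ ⊗₁∘id⊗₁ ⟩∘⟨refl ⟩
    (! u ⊗₁ j₂ v w) ∘ λ⇐                                ≈⟨ j₂-∘ (j₂ v w) ⟨
    j₂ u (v ⊗₀ w) ∘ j₂ v w                             ∎

module EFunctorReasoning {E : Category o ℓ e} {C : Category o′ ℓ′ e′} (F : EFunctor E C) where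
  open EFunctor F public using (T; Tm; τ)
  open HomReasoning C
  private
    module E = Category E
    module F = EFunctor F

  Tm-id : ∀ {u A} → Tm u (id {A}) ≈ id
  Tm-id {u} = Functor.identity (F.T₀ u)

  Tm-∘ : ∀ {u A B D} {f : A ⇒ B} {g : B ⇒ D} → Tm u (g ∘ f) ≈ Tm u g ∘ Tm u f
  Tm-∘ {u} = Functor.homomorphism (F.T₀ u)

  Tm-resp-≈ : ∀ {u A B} {f g : A ⇒ B} → f ≈ g → Tm u f ≈ Tm u g
  Tm-resp-≈ {u} = Functor.F-resp-≈ (F.T₀ u)

  τ-commute : ∀ {u v} (f : E [ u , v ]) {A B} (h : A ⇒ B) → τ f B ∘ Tm u h ≈ Tm v h ∘ τ f A
  τ-commute f = NatTrans.commute (F.T₁ f)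

  τ-id : ∀ {u} A → τ (E.id {u}) A ≈ id
  τ-id = F.identity

  τ-∘ : ∀ {u v w} {f : E [ u , v ]} {g : E [ v , w ]} A → τ (g E.∘ f) A ≈ τ g A ∘ τ f A
  τ-∘ = F.homomorphism

  τ-resp-≈ : ∀ {u v} {f g : E [ u , v ]} → f E.≈ g → ∀ A → τ f A ≈ τ g A
  τ-resp-≈ = F.resp-≈

  τ-resp-∘ : ∀ {u v w} {f : E [ u , v ]} {g : E [ v , w ]} {h : E [ u , w ]} →
             g E.∘ f E.≈ h → ∀ {A} → τ g A ∘ τ f A ≈ τ h A
  τ-resp-∘ p {A} = ≈-trans (≈-sym (τ-∘ A)) (τ-resp-≈ p A)

  τ₂ : ∀ {u u′ v v′} → E [ u , u′ ] → E [ v , v′ ] → ∀ A → T u (T v A) ⇒ T u′ (T v′ A)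
  τ₂ {u} {v′ = v′} f g A = τ f (T v′ A) ∘ Tm u (τ g A)

  τ₂-id : ∀ {u v A} → τ₂ (E.id {u}) (E.id {v}) A ≈ id
  τ₂-id = ≈-trans (τ-id _ ⟩∘⟨ ≈-trans (Tm-resp-≈ (τ-id _)) Tm-id) identityˡ

  τ₂-∘ : ∀ {u u′ u″ v v′ v″} {f : E [ u′ , u″ ]} {g : E [ v′ , v″ ]}
           {f′ : E [ u , u′ ]} {g′ : E [ v , v′ ]} {A} →
         τ₂ f g A ∘ τ₂ f′ g′ A ≈ τ₂ (f E.∘ f′) (g E.∘ g′) A
  τ₂-∘ {u} {u′} {f = f} {g} {f′} {g′} {A} = begin
    (τ f _ ∘ Tm u′ (τ g A)) ∘ (τ f′ _ ∘ Tm u (τ g′ A))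
      ≈⟨ pullʳ (pullˡ (≈-sym (τ-commute f′ (τ g A)))) ⟩
    τ f _ ∘ ((τ f′ _ ∘ Tm u (τ g A)) ∘ Tm u (τ g′ A))
      ≈⟨ refl⟩∘⟨ assoc ⟩
    τ f _ ∘ (τ f′ _ ∘ (Tm u (τ g A) ∘ Tm u (τ g′ A)))
      ≈⟨ sym-assoc ⟩
    (τ f _ ∘ τ f′ _) ∘ (Tm u (τ g A) ∘ Tm u (τ g′ A))
      ≈⟨ τ-∘ _ ⟩∘⟨ ≈-trans (Tm-resp-≈ (τ-∘ A)) Tm-∘ ⟨
    τ₂ (f E.∘ f′) (g E.∘ g′) A
      ∎

  τ₂-natural : ∀ {u u′ v v′} (f : E [ u , u′ ]) (g : E [ v , v′ ]) {A B} (h : A ⇒ B) →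
               τ₂ f g B ∘ Tm u (Tm v h) ≈ Tm u′ (Tm v′ h) ∘ τ₂ f g A
  τ₂-natural {u} {v = v} {v′} f g h = begin
    (τ f _ ∘ Tm u (τ g _)) ∘ Tm u (Tm v h)  ≈⟨ pullʳ (≈-sym Tm-∘) ⟩
    τ f _ ∘ Tm u (τ g _ ∘ Tm v h)           ≈⟨ refl⟩∘⟨ Tm-resp-≈ (τ-commute g h) ⟩
    τ f _ ∘ Tm u (Tm v′ h ∘ τ g _)          ≈⟨ refl⟩∘⟨ Tm-∘ ⟩
    τ f _ ∘ (Tm u (Tm v′ h) ∘ Tm u (τ g _)) ≈⟨ pullˡ (τ-commute f (Tm v′ h)) ⟩
    (Tm _ (Tm v′ h) ∘ τ f _) ∘ Tm u (τ g _) ≈⟨ assoc ⟩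
    Tm _ (Tm v′ h) ∘ τ₂ f g _               ∎

module MixedMultiplication {E : Category o ℓ e} {C : Category o′ ℓ′ e′} {F : EFunctor E C}
                           (M : IndexedMonad E C F) where
  open HomReasoning C
  open EFunctorReasoning F
  open IndexedMonad M renaming (assoc to μ-assoc)
  private module E = Category E

  μ⟨_,_⟩ : ∀ {u v X} → E [ u , X ] → E [ v , X ] → ∀ A → T u (T v A) ⇒ T X A
  μ⟨_,_⟩ {X = X} a b A = μ X A ∘ τ₂ a b A

  μ₃⟨_,_,_⟩ : ∀ {u v w X} → E [ u , X ] → E [ v , X ] → E [ w , X ] → ∀ A →
              T u (T v (T w A)) ⇒ T X A
  μ₃⟨_,_,_⟩ {u} {X = X} a b c A = μ X A ∘ (τ a (T X A) ∘ Tm u (μ⟨ b , c ⟩ A))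

  μ⟨⟩-resp-≈ : ∀ {u v X} {a a′ : E [ u , X ]} {b b′ : E [ v , X ]} →
               a E.≈ a′ → b E.≈ b′ → ∀ A → μ⟨ a , b ⟩ A ≈ μ⟨ a′ , b′ ⟩ A
  μ⟨⟩-resp-≈ p q A = refl⟩∘⟨ τ-resp-≈ p _ ⟩∘⟨ Tm-resp-≈ (τ-resp-≈ q A)

  μ₃⟨⟩-resp-≈ : ∀ {u v w X} {a a′ : E [ u , X ]} {b b′ : E [ v , X ]} {c c′ : E [ w , X ]} →
                a E.≈ a′ → b E.≈ b′ → c E.≈ c′ → ∀ A → μ₃⟨ a , b , c ⟩ A ≈ μ₃⟨ a′ , b′ , c′ ⟩ A
  μ₃⟨⟩-resp-≈ p q r A = refl⟩∘⟨ τ-resp-≈ p _ ⟩∘⟨ Tm-resp-≈ (μ⟨⟩-resp-≈ q r A)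

  μ⟨⟩-natural : ∀ {u v X} (a : E [ u , X ]) (b : E [ v , X ]) {A B} (h : A ⇒ B) →
                μ⟨ a , b ⟩ B ∘ Tm u (Tm v h) ≈ Tm X h ∘ μ⟨ a , b ⟩ A
  μ⟨⟩-natural {X = X} a b h = glue (τ₂-natural a b h) (μ-natural X h)

  μ⟨id,id⟩ : ∀ {u A} → μ⟨ E.id , E.id ⟩ A ≈ μ u A
  μ⟨id,id⟩ = elimʳ τ₂-id

  τ∘μ⟨⟩ : ∀ {u v X Y} (f : E [ X , Y ]) {a : E [ u , X ]} {b : E [ v , X ]} A →
          τ f A ∘ μ⟨ a , b ⟩ A ≈ μ⟨ f E.∘ a , f E.∘ b ⟩ A
  τ∘μ⟨⟩ f A = ≈-trans (pullˡ (hom-μ f A)) (pullʳ τ₂-∘)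

  μ⟨⟩∘τ₂ : ∀ {u u′ v v′ X} {a : E [ u′ , X ]} {b : E [ v′ , X ]}
             (f : E [ u , u′ ]) (g : E [ v , v′ ]) A →
           μ⟨ a , b ⟩ A ∘ τ₂ f g A ≈ μ⟨ a E.∘ f , b E.∘ g ⟩ A
  μ⟨⟩∘τ₂ f g A = pullʳ τ₂-∘

  μ⟨⟩∘η : ∀ {u v X} (a : E [ u , X ]) (b : E [ v , X ]) A → μ⟨ a , b ⟩ A ∘ η u (T v A) ≈ τ b A
  μ⟨⟩∘η {u} {X = X} a b A = begin
    (μ X A ∘ (τ a _ ∘ Tm u (τ b A))) ∘ η u _  ≈⟨ pullʳ (pullʳ (≈-sym (η-natural u (τ b A)))) ⟩
    μ X A ∘ (τ a _ ∘ (η u _ ∘ τ b A))         ≈⟨ refl⟩∘⟨ pullˡ (hom-η a _) ⟩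
    μ X A ∘ (η X _ ∘ τ b A)                   ≈⟨ cancelˡ (unitˡ X A) ⟩
    τ b A                                     ∎

  μ⟨⟩∘Tη : ∀ {u v X} (a : E [ u , X ]) (b : E [ v , X ]) A → μ⟨ a , b ⟩ A ∘ Tm u (η v A) ≈ τ a A
  μ⟨⟩∘Tη {u} {X = X} a b A = begin
    (μ X A ∘ (τ a _ ∘ Tm u (τ b A))) ∘ Tm u (η _ A)  ≈⟨ pullʳ (pullʳ (≈-sym Tm-∘)) ⟩
    μ X A ∘ (τ a _ ∘ Tm u (τ b A ∘ η _ A))           ≈⟨ refl⟩∘⟨ refl⟩∘⟨ Tm-resp-≈ (hom-η b A) ⟩
    μ X A ∘ (τ a _ ∘ Tm u (η X A))                   ≈⟨ refl⟩∘⟨ τ-commute a (η X A) ⟩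
    μ X A ∘ (Tm X (η X A) ∘ τ a A)                   ≈⟨ cancelˡ (unitʳ X A) ⟩
    τ a A                                            ∎

  μ∘μ⟨⟩ : ∀ {u v X} (a : E [ u , X ]) (b : E [ v , X ]) A →
          μ X A ∘ μ⟨ a , b ⟩ (T X A) ≈ μ X A ∘ (τ a (T X A) ∘ Tm u (μ X A ∘ τ b (T X A)))
  μ∘μ⟨⟩ {u} {X = X} a b A = begin
    μ X A ∘ (μ X _ ∘ (τ a _ ∘ Tm u (τ b _)))         ≈⟨ pullˡ (μ-assoc X A) ⟩
    (μ X A ∘ Tm X (μ X A)) ∘ (τ a _ ∘ Tm u (τ b _))  ≈⟨ pullʳ (pullˡ (≈-sym (τ-commute a (μ X A)))) ⟩
    μ X A ∘ ((τ a _ ∘ Tm u (μ X A)) ∘ Tm u (τ b _))  ≈⟨ refl⟩∘⟨ pullʳ (≈-sym Tm-∘) ⟩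
    μ X A ∘ (τ a _ ∘ Tm u (μ X A ∘ τ b _))           ∎

  μ⟨⟩∘μ⟨⟩ : ∀ {u v w X Y} (p : E [ u , Y ]) (q : E [ v , Y ]) (x : E [ Y , X ]) (c : E [ w , X ])
            A →
            μ⟨ x , c ⟩ A ∘ μ⟨ p , q ⟩ (T w A) ≈ μ₃⟨ x E.∘ p , x E.∘ q , c ⟩ A
  μ⟨⟩∘μ⟨⟩ {u} {v} {X = X} p q x c A = begin
    (μ X A ∘ (τ x _ ∘ Tm _ (τ c A))) ∘ μ⟨ p , q ⟩ _
      ≈⟨ pullʳ (pullʳ (≈-sym (μ⟨⟩-natural p q (τ c A)))) ⟩
    μ X A ∘ (τ x _ ∘ (μ⟨ p , q ⟩ _ ∘ Tm u (Tm v (τ c A))))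
      ≈⟨ refl⟩∘⟨ pullˡ (τ∘μ⟨⟩ x _) ⟩
    μ X A ∘ (μ⟨ x E.∘ p , x E.∘ q ⟩ _ ∘ Tm u (Tm v (τ c A)))
      ≈⟨ pullˡ (μ∘μ⟨⟩ _ _ A) ⟩
    (μ X A ∘ (τ (x E.∘ p) _ ∘ Tm u (μ X A ∘ τ (x E.∘ q) _))) ∘ Tm u (Tm v (τ c A))
      ≈⟨ pullʳ (pullʳ (≈-trans (≈-sym Tm-∘) (Tm-resp-≈ assoc))) ⟩
    μ₃⟨ x E.∘ p , x E.∘ q , c ⟩ A
      ∎

  μ⟨⟩∘Tμ⟨⟩ : ∀ {u v w X Y} (a : E [ u , X ]) (b : E [ Y , X ]) (c : E [ v , Y ]) (d : E [ w , Y ])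
             A →
             μ⟨ a , b ⟩ A ∘ Tm u (μ⟨ c , d ⟩ A) ≈ μ₃⟨ a , b E.∘ c , b E.∘ d ⟩ A
  μ⟨⟩∘Tμ⟨⟩ a b c d A =
    pullʳ (pullʳ (≈-trans (≈-sym Tm-∘) (Tm-resp-≈ (τ∘μ⟨⟩ b A))))

module IndexedToGraded (𝔼 : MonoidalCategory o ℓ e) (C : Category o′ ℓ′ e′)
                       (init : IsInitial (MonoidalCategory.U 𝔼) (MonoidalCategory.unit 𝔼))
                       {F : EFunctor (MonoidalCategory.U 𝔼) C}
                       (M : IndexedMonad (MonoidalCategory.U 𝔼) C F) where
  private module E = InitialUnit 𝔼 init
  open HomReasoning C
  open EFunctorReasoning F
  open IndexedMonad M using (η; η-natural)
  open MixedMultiplication M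

  μᵍ : ∀ u v A → T u (T v A) ⇒ T (u E.⊗₀ v) A
  μᵍ u v = μ⟨ E.j₁ u v , E.j₂ u v ⟩

  μᵍ-natural-grade : ∀ {u u′ v v′} (f : E.U [ u , u′ ]) (g : E.U [ v , v′ ]) A →
                     τ (f E.⊗₁ g) A ∘ μᵍ u v A ≈ μᵍ u′ v′ A ∘ τ₂ f g A
  μᵍ-natural-grade f g A = begin
    τ (f E.⊗₁ g) A ∘ μᵍ _ _ A
      ≈⟨ τ∘μ⟨⟩ _ A ⟩
    μ⟨ (f E.⊗₁ g) E.∘ E.j₁ _ _ , (f E.⊗₁ g) E.∘ E.j₂ _ _ ⟩ A
      ≈⟨ μ⟨⟩-resp-≈ (E.⊗₁-j₁ f g) (E.⊗₁-j₂ f g) A ⟩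
    μ⟨ E.j₁ _ _ E.∘ f , E.j₂ _ _ E.∘ g ⟩ A
      ≈⟨ μ⟨⟩∘τ₂ f g A ⟨
    μᵍ _ _ A ∘ τ₂ f g A
      ∎

  μᵍ-unitˡ : ∀ u A → τ E.λ⇒ A ∘ (μᵍ E.unit u A ∘ η E.unit (T u A)) ≈ id
  μᵍ-unitˡ u A = ≈-trans (refl⟩∘⟨ μ⟨⟩∘η _ _ A) (≈-trans (τ-resp-∘ E.λ-j₂) (τ-id A))

  μᵍ-unitʳ : ∀ u A → τ E.ρ⇒ A ∘ (μᵍ u E.unit A ∘ Tm u (η E.unit A)) ≈ id
  μᵍ-unitʳ u A = ≈-trans (refl⟩∘⟨ μ⟨⟩∘Tη _ _ A) (≈-trans (τ-resp-∘ E.ρ-j₁) (τ-id A))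

  μᵍ-assoc : ∀ u v w A →
             τ E.α⇒ A ∘ (μᵍ (u E.⊗₀ v) w A ∘ μᵍ u v (T w A)) ≈ μᵍ u (v E.⊗₀ w) A ∘ Tm u (μᵍ v w A)
  μᵍ-assoc u v w A = begin
    τ E.α⇒ A ∘ (μᵍ (u E.⊗₀ v) w A ∘ μᵍ u v (T w A))   ≈⟨ pullˡ (τ∘μ⟨⟩ E.α⇒ A) ⟩
    μ⟨ E.α⇒ E.∘ E.j₁ _ _ , E.α⇒ E.∘ E.j₂ _ _ ⟩ A ∘ μᵍ u v (T w A)  ≈⟨ μ⟨⟩∘μ⟨⟩ _ _ _ _ A ⟩
    μ₃⟨ (E.α⇒ E.∘ E.j₁ _ _) E.∘ E.j₁ u v , (E.α⇒ E.∘ E.j₁ _ _) E.∘ E.j₂ u v , E.α⇒ E.∘ E.j₂ _ _ ⟩ A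
      ≈⟨ μ₃⟨⟩-resp-≈ (E.≈-trans E.assoc E.α-j₁j₁) (E.≈-trans E.assoc E.α-j₁j₂) E.α-j₂ A ⟩
    μ₃⟨ E.j₁ u (v E.⊗₀ w) , E.j₂ u (v E.⊗₀ w) E.∘ E.j₁ v w , E.j₂ u (v E.⊗₀ w) E.∘ E.j₂ v w ⟩ A
      ≈⟨ μ⟨⟩∘Tμ⟨⟩ _ _ _ _ A ⟨
    μᵍ u (v E.⊗₀ w) A ∘ Tm u (μᵍ v w A)               ∎

  graded : GradedMonad 𝔼 C F
  graded = record
    { η = η E.unit
    ; η-natural = η-natural E.unit
    ; μ = μᵍ
    ; μ-natural = λ u v → μ⟨⟩-natural (E.j₁ u v) (E.j₂ u v)
    ; μ-natural-grade = μᵍ-natural-grade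
    ; unitˡ = μᵍ-unitˡ
    ; unitʳ = μᵍ-unitʳ
    ; assoc = μᵍ-assoc
    }

  isIndexedToGraded : IsIndexedToGraded 𝔼 C init M graded
  isIndexedToGraded = (λ _ → ≈-refl) , (λ _ _ _ → ≈-refl)

module GradedToIndexed (𝔼 : MonoidalCategory o ℓ e) (C : Category o′ ℓ′ e′)
                       (init : IsInitial (MonoidalCategory.U 𝔼) (MonoidalCategory.unit 𝔼))
                       (cd : HasCodiagonals 𝔼)
                       {F : EFunctor (MonoidalCategory.U 𝔼) C} (G : GradedMonad 𝔼 C F) where
  private module E = InitialUnit 𝔼 init
  open HomReasoning C
  open EFunctorReasoning F
  open GradedMonad G renaming (assoc to μ-assoc)
  open HasCodiagonals cd

  μ-natural-gradeˡ : ∀ {u u′ v} (f : E.U [ u , u′ ]) A →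
                     μ u′ v A ∘ τ f (T v A) ≈ τ (f E.⊗₁ E.id) A ∘ μ u v A
  μ-natural-gradeˡ f A =
    ≈-sym (≈-trans (μ-natural-grade f E.id A) (refl⟩∘⟨ elimʳ (≈-trans (Tm-resp-≈ (τ-id A)) Tm-id)))

  μ-natural-gradeʳ : ∀ {u v v′} (g : E.U [ v , v′ ]) A →
                     μ u v′ A ∘ Tm u (τ g A) ≈ τ (E.id E.⊗₁ g) A ∘ μ u v A
  μ-natural-gradeʳ g A = ≈-sym (≈-trans (μ-natural-grade E.id g A) (refl⟩∘⟨ elimˡ (τ-id _)))

  ηⁱ : ∀ u A → A ⇒ T u A
  ηⁱ u A = τ (E.! u) A ∘ η A

  μⁱ : ∀ u A → T u (T u A) ⇒ T u A
  μⁱ u A = τ (∇ u) A ∘ μ u u A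

  μⁱ-unitˡ : ∀ u A → μⁱ u A ∘ ηⁱ u (T u A) ≈ id
  μⁱ-unitˡ u A = begin
    (τ (∇ u) A ∘ μ u u A) ∘ (τ (E.! u) _ ∘ η _)
      ≈⟨ pullʳ (pullˡ (μ-natural-gradeˡ (E.! u) A)) ⟩
    τ (∇ u) A ∘ ((τ (E.! u E.⊗₁ E.id) A ∘ μ E.unit u A) ∘ η _)
      ≈⟨ refl⟩∘⟨ assoc ⟩
    τ (∇ u) A ∘ (τ (E.! u E.⊗₁ E.id) A ∘ (μ E.unit u A ∘ η _))
      ≈⟨ pullˡ (τ-resp-∘ (∇-unitˡ (E.! u))) ⟩
    τ E.λ⇒ A ∘ (μ E.unit u A ∘ η _)
      ≈⟨ unitˡ u A ⟩
    id
      ∎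

  μⁱ-unitʳ : ∀ u A → μⁱ u A ∘ Tm u (ηⁱ u A) ≈ id
  μⁱ-unitʳ u A = begin
    (τ (∇ u) A ∘ μ u u A) ∘ Tm u (τ (E.! u) A ∘ η A)
      ≈⟨ refl⟩∘⟨ Tm-∘ ⟩
    (τ (∇ u) A ∘ μ u u A) ∘ (Tm u (τ (E.! u) A) ∘ Tm u (η A))
      ≈⟨ pullʳ (pullˡ (μ-natural-gradeʳ (E.! u) A)) ⟩
    τ (∇ u) A ∘ ((τ (E.id E.⊗₁ E.! u) A ∘ μ u E.unit A) ∘ Tm u (η A))
      ≈⟨ refl⟩∘⟨ assoc ⟩
    τ (∇ u) A ∘ (τ (E.id E.⊗₁ E.! u) A ∘ (μ u E.unit A ∘ Tm u (η A)))
      ≈⟨ pullˡ (τ-resp-∘ (∇-unitʳ (E.! u))) ⟩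
    τ E.ρ⇒ A ∘ (μ u E.unit A ∘ Tm u (η A))
      ≈⟨ unitʳ u A ⟩
    id
      ∎

  μⁱ-assoc : ∀ u A → μⁱ u A ∘ μⁱ u (T u A) ≈ μⁱ u A ∘ Tm u (μⁱ u A)
  μⁱ-assoc u A = begin
    (τ (∇ u) A ∘ μ u u A) ∘ (τ (∇ u) _ ∘ μ u u _)
      ≈⟨ pullʳ (pullˡ (μ-natural-gradeˡ (∇ u) A)) ⟩
    τ (∇ u) A ∘ ((τ (∇ u E.⊗₁ E.id) A ∘ μ (u E.⊗₀ u) u A) ∘ μ u u _)
      ≈⟨ refl⟩∘⟨ assoc ⟩
    τ (∇ u) A ∘ (τ (∇ u E.⊗₁ E.id) A ∘ (μ (u E.⊗₀ u) u A ∘ μ u u _))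
      ≈⟨ pullˡ (τ-resp-∘ (E.≈-trans (∇-assoc u) E.sym-assoc)) ⟩
    τ ((∇ u E.∘ (E.id E.⊗₁ ∇ u)) E.∘ E.α⇒) A ∘ (μ (u E.⊗₀ u) u A ∘ μ u u _)
      ≈⟨ pushˡ (τ-∘ A) ⟩
    τ (∇ u E.∘ (E.id E.⊗₁ ∇ u)) A ∘ (τ E.α⇒ A ∘ (μ (u E.⊗₀ u) u A ∘ μ u u _))
      ≈⟨ refl⟩∘⟨ μ-assoc u u u A ⟩
    τ (∇ u E.∘ (E.id E.⊗₁ ∇ u)) A ∘ (μ u (u E.⊗₀ u) A ∘ Tm u (μ u u A))
      ≈⟨ pushˡ (τ-∘ A) ⟩
    τ (∇ u) A ∘ (τ (E.id E.⊗₁ ∇ u) A ∘ (μ u (u E.⊗₀ u) A ∘ Tm u (μ u u A)))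
      ≈⟨ refl⟩∘⟨ pullˡ (≈-sym (μ-natural-gradeʳ (∇ u) A)) ⟩
    τ (∇ u) A ∘ ((μ u u A ∘ Tm u (τ (∇ u) A)) ∘ Tm u (μ u u A))
      ≈⟨ refl⟩∘⟨ pullʳ (≈-sym Tm-∘) ⟩
    τ (∇ u) A ∘ (μ u u A ∘ Tm u (μⁱ u A))
      ≈⟨ sym-assoc ⟩
    μⁱ u A ∘ Tm u (μⁱ u A)
      ∎

  τ∘ηⁱ : ∀ {u v} (f : E.U [ u , v ]) A → τ f A ∘ ηⁱ u A ≈ ηⁱ v A
  τ∘ηⁱ f A = pullˡ (τ-resp-∘ (E.!-unique₂ _ _))

  τ∘μⁱ : ∀ {u v} (f : E.U [ u , v ]) A → τ f A ∘ μⁱ u A ≈ μⁱ v A ∘ τ₂ f f A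
  τ∘μⁱ {u} {v} f A = begin
    τ f A ∘ (τ (∇ u) A ∘ μ u u A)           ≈⟨ pullˡ (τ-resp-∘ (E.≈-sym (∇-natural f))) ⟩
    τ (∇ v E.∘ (f E.⊗₁ f)) A ∘ μ u u A      ≈⟨ pushˡ (τ-∘ A) ⟩
    τ (∇ v) A ∘ (τ (f E.⊗₁ f) A ∘ μ u u A)  ≈⟨ refl⟩∘⟨ μ-natural-grade f f A ⟩
    τ (∇ v) A ∘ (μ v v A ∘ τ₂ f f A)        ≈⟨ sym-assoc ⟩
    μⁱ v A ∘ τ₂ f f A                       ∎

  indexed : IndexedMonad E.U C F
  indexed = record
    { η = ηⁱ
    ; η-natural = λ u h → glue (η-natural h) (τ-commute (E.! u) h)
    ; μ = μⁱ
    ; μ-natural = λ u h → glue (μ-natural u u h) (τ-commute (∇ u) h)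
    ; unitˡ = μⁱ-unitˡ
    ; unitʳ = μⁱ-unitʳ
    ; assoc = μⁱ-assoc
    ; hom-η = τ∘ηⁱ
    ; hom-μ = τ∘μⁱ
    }

  isGradedToIndexed : IsGradedToIndexed 𝔼 C init ∇ G indexed
  isGradedToIndexed = (λ _ _ → ≈-refl) , (λ _ _ → ≈-refl)

module Roundtrip (𝔼 : MonoidalCategory o ℓ e) (C : Category o′ ℓ′ e′)
                 (init : IsInitial (MonoidalCategory.U 𝔼) (MonoidalCategory.unit 𝔼))
                 (cd : HasCodiagonals 𝔼) {F : EFunctor (MonoidalCategory.U 𝔼) C} where
  private module E = InitialUnit 𝔼 init
  open HomReasoning C
  open EFunctorReasoning F
  open HasCodiagonals cd

  toGraded : IndexedMonad E.U C F → GradedMonad 𝔼 C F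
  toGraded = IndexedToGraded.graded 𝔼 C init

  toIndexed : GradedMonad 𝔼 C F → IndexedMonad E.U C F
  toIndexed = GradedToIndexed.indexed 𝔼 C init cd

  ∇-j₁ : ∀ u → ∇ u E.∘ E.j₁ u u E.≈ E.id
  ∇-j₁ u = E.≈-trans (E.pullˡ (∇-unitʳ (E.! u))) E.ρ-isoʳ

  ∇-j₂ : ∀ u → ∇ u E.∘ E.j₂ u u E.≈ E.id
  ∇-j₂ u = E.≈-trans (E.pullˡ (∇-unitˡ (E.! u))) E.λ-isoʳ

  toIndexed-toGraded : ∀ M → IndexedEq E.U C (toIndexed (toGraded M)) M
  toIndexed-toGraded M = (λ u → hom-η (E.! u)) , λ u A → begin
    τ (∇ u) A ∘ μ⟨ E.j₁ u u , E.j₂ u u ⟩ A         ≈⟨ τ∘μ⟨⟩ (∇ u) A ⟩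
    μ⟨ ∇ u E.∘ E.j₁ u u , ∇ u E.∘ E.j₂ u u ⟩ A    ≈⟨ μ⟨⟩-resp-≈ (∇-j₁ u) (∇-j₂ u) A ⟩
    μ⟨ E.id , E.id ⟩ A                            ≈⟨ μ⟨id,id⟩ ⟩
    μ u A                                         ∎
    where
      open IndexedMonad M using (μ; hom-η)
      open MixedMultiplication M

  toGraded-toIndexed : (∀ u v → ∇ (u E.⊗₀ v) E.∘ (E.j₁ u v E.⊗₁ E.j₂ u v) E.≈ E.id) →
                       ∀ G → GradedEq 𝔼 C (toGraded (toIndexed G)) G
  toGraded-toIndexed ∇-j₁⊗j₂ G =
    (λ A → elimˡ (≈-trans (τ-resp-≈ E.!-unit A) (τ-id A))) , λ u v A → begin
      (τ (∇ (u E.⊗₀ v)) A ∘ μ _ _ A) ∘ τ₂ (E.j₁ u v) (E.j₂ u v) A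
        ≈⟨ pullʳ (≈-sym (μ-natural-grade _ _ A)) ⟩
      τ (∇ (u E.⊗₀ v)) A ∘ (τ (E.j₁ u v E.⊗₁ E.j₂ u v) A ∘ μ u v A)
        ≈⟨ pullˡ (τ-resp-∘ (∇-j₁⊗j₂ u v)) ⟩
      τ E.id A ∘ μ u v A
        ≈⟨ elimˡ (τ-id A) ⟩
      μ u v A
        ∎
    where open GradedMonad G using (μ; μ-natural-grade)

module Cocartesian (𝔼 : MonoidalCategory o ℓ e) (cc : IsCocartesian 𝔼) where
  open IsCocartesian cc
  open InitialUnit 𝔼 unit-initial

  ι-jointly-epic : ∀ {A B X} {h k : A ⊗₀ B ⇒ X} → h ∘ ι₁ ≈ k ∘ ι₁ → h ∘ ι₂ ≈ k ∘ ι₂ → h ≈ k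
  ι-jointly-epic {h = h} {k} p q = ≈-trans ([]-unique h p q) (≈-sym ([]-unique k ≈-refl ≈-refl))

  ∇ : ∀ u → u ⊗₀ u ⇒ u
  ∇ u = copair id id

  ∇∘⊗₁-ι₁ : ∀ {u A B} {f : A ⇒ u} {g : B ⇒ u} → (∇ u ∘ (f ⊗₁ g)) ∘ ι₁ ≈ f
  ∇∘⊗₁-ι₁ = ≈-trans (pullʳ ⊗₁-ι₁) (cancelˡ inject₁)

  ∇∘⊗₁-ι₂ : ∀ {u A B} {f : A ⇒ u} {g : B ⇒ u} → (∇ u ∘ (f ⊗₁ g)) ∘ ι₂ ≈ g
  ∇∘⊗₁-ι₂ = ≈-trans (pullʳ ⊗₁-ι₂) (cancelˡ inject₂)

  ∇-assoc : ∀ A → ∇ A ∘ (∇ A ⊗₁ id) ≈ ∇ A ∘ ((id ⊗₁ ∇ A) ∘ α⇒)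
  ∇-assoc A = ι-jointly-epic
    (ι-jointly-epic (≈-trans (≈-trans (∇∘⊗₁-ι₁ ⟩∘⟨refl) inject₁) (≈-sym (≈-trans assoc right₁₁)))
                    (≈-trans (≈-trans (∇∘⊗₁-ι₁ ⟩∘⟨refl) inject₂) (≈-sym (≈-trans assoc right₁₂))))
    (≈-trans ∇∘⊗₁-ι₂ (≈-sym right₂))
    where
      right∘ : ∀ {X} (x : X ⇒ (A ⊗₀ A) ⊗₀ A) →
               (∇ A ∘ ((id ⊗₁ ∇ A) ∘ α⇒)) ∘ x ≈ (∇ A ∘ (id ⊗₁ ∇ A)) ∘ (α⇒ ∘ x)
      right∘ x = ≈-trans (sym-assoc ⟩∘⟨refl) assoc
      right₁₁ : (∇ A ∘ ((id ⊗₁ ∇ A) ∘ α⇒)) ∘ (ι₁ ∘ ι₁) ≈ id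
      right₁₁ = ≈-trans (right∘ _) (≈-trans (refl⟩∘⟨ α-ι₁ι₁) ∇∘⊗₁-ι₁)
      right₁₂ : (∇ A ∘ ((id ⊗₁ ∇ A) ∘ α⇒)) ∘ (ι₁ ∘ ι₂) ≈ id
      right₁₂ = ≈-trans (right∘ _) (≈-trans (refl⟩∘⟨ α-ι₁ι₂) (≈-trans (pullˡ ∇∘⊗₁-ι₂) inject₁))
      right₂ : (∇ A ∘ ((id ⊗₁ ∇ A) ∘ α⇒)) ∘ ι₂ ≈ id
      right₂ = ≈-trans (right∘ _) (≈-trans (refl⟩∘⟨ α-ι₂) (≈-trans (pullˡ ∇∘⊗₁-ι₂) inject₂))

  codiagonals : HasCodiagonals 𝔼
  codiagonals = record
    { ∇ = ∇
    ; ∇-natural = λ f → ι-jointly-epic (≈-trans ∇∘⊗₁-ι₁ (≈-sym (cancelʳ inject₁)))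
                                       (≈-trans ∇∘⊗₁-ι₂ (≈-sym (cancelʳ inject₂)))
    ; ∇-assoc = ∇-assoc
    ; ∇-unitˡ = λ _ → ι-jointly-epic (!-unique₂ _ _) (≈-trans ∇∘⊗₁-ι₂ (≈-sym λ-ι₂))
    ; ∇-unitʳ = λ _ → ι-jointly-epic (≈-trans ∇∘⊗₁-ι₁ (≈-sym ρ-ι₁)) (!-unique₂ _ _)
    }

  j₁≈ι₁ : ∀ {u v} → j₁ u v ≈ ι₁
  j₁≈ι₁ = ≈-trans (refl⟩∘⟨ ρ⇐≈ι₁) (≈-trans ⊗₁-ι₁ identityʳ)
    where
      ρ⇐≈ι₁ : ∀ {u} → ρ⇐ {u} ≈ ι₁
      ρ⇐≈ι₁ = ≈-trans (≈-sym (elimʳ ρ-ι₁)) (cancelˡ ρ-isoˡ)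

  j₂≈ι₂ : ∀ {u v} → j₂ u v ≈ ι₂
  j₂≈ι₂ = ≈-trans (refl⟩∘⟨ λ⇐≈ι₂) (≈-trans ⊗₁-ι₂ identityʳ)
    where
      λ⇐≈ι₂ : ∀ {u} → λ⇐ {u} ≈ ι₂
      λ⇐≈ι₂ = ≈-trans (≈-sym (elimʳ λ-ι₂)) (cancelˡ λ-isoˡ)

  ∇-j₁⊗j₂ : ∀ u v → ∇ (u ⊗₀ v) ∘ (j₁ u v ⊗₁ j₂ u v) ≈ id
  ∇-j₁⊗j₂ u v = ι-jointly-epic (≈-trans ∇∘⊗₁-ι₁ (≈-trans j₁≈ι₁ (≈-sym identityˡ)))
                               (≈-trans ∇∘⊗₁-ι₂ (≈-trans j₂≈ι₂ (≈-sym identityˡ)))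

lemma4p7 : ∀ {o ℓ e o′ ℓ′ e′} (E : MonoidalCategory o ℓ e) (C : Category o′ ℓ′ e′) →
    Part1 E C × Part2 E C × Part3 E C
lemma4p7 E C = part1 , part2 , part3
  where
    part1 : Part1 E C
    part1 init F M = graded , isIndexedToGraded
      where open IndexedToGraded E C init M

    part2 : Part2 E C
    part2 init cd F G = indexed , isGradedToIndexed
      where open GradedToIndexed E C init cd G

    part3 : Part3 E C
    part3 cc F =
      toGraded , toIndexed ,
      IndexedToGraded.isIndexedToGraded E C unit-initial ,
      GradedToIndexed.isGradedToIndexed E C unit-initial codiagonals ,
      toGraded-toIndexed ∇-j₁⊗j₂ , toIndexed-toGraded
      where
        open IsCocartesian cc using (unit-initial)
        open Cocartesian E cc using (codiagonals; ∇-j₁⊗j₂)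
        open Roundtrip E C unit-initial codiagonals {F}
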